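{- Let $n \geq 3$, $i \in [n]$, and let $e=(u,v)$ be an edge of $S_n^{2:i}$. Then there exist $u' \in \{us_n^+, us_n^-\}$ and $v' \in \{vs_n^+, vs_n^-\}$ such that $e'=(u',v')$ is an edge of $S_n^{2:j}$ for some $j \in [n]\setminus\{i\}$ (such an $e'$ is called a coupled pair-edge of $e$). Moreover, $\langle u, u', v', v, u\rangle$ is a 4-cycle in $S_n^2$.
   Context: For $n \geq 3$, the split-star network $S_n^2$ is the graph whose vertex set is the set of all permutations of $[n]$, written as strings $x_1x_2\cdots x_n$. For a vertex $u = x_1\cdots x_n$: $u\circ(1,2)$ is the vertex $y_1\cdots y_n$ with $y_1=x_2$, $y_2=x_1$, $y_j=x_j$ for $j\in[3,n]$; for $k \in [3,n]$, $us_k^-$ is the vertex with $y_1 = x_2$, $y_2 = x_k$, $y_k = x_1$, $y_j = x_j$ for $j\in[3,n]\setminus\{k\}$; and $us_k^+$ is the vertex with $y_1 = x_k$, $y_2 = x_1$, $y_k = x_2$, $y_j = x_j$ for $j\in[3,n]\setminus\{k\}$. The edges of $S_n^2$ are exactly the pairs $\{u, u\circ(1,2)\}$, $\{u, us_k^-\}$, $\{u, us_k^+\}$ for $u$ a vertex and $k \in [3,n]$. For $i \in [n]$, $S_n^{2:i}$ is the subgraph of $S_n^2$ induced by all vertices whose last symbol is $i$. -}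

module Defs where

open import Data.Nat using (ℕ; zero; suc; _≤_)
open import Data.Fin using (Fin; zero; suc; toℕ; fromℕ)
open import Data.Vec using (Vec; lookup; _[_]≔_; last)
open import Data.Vec.Relation.Unary.Unique.Propositional using (Unique)
open import Data.Product using (Σ; _×_)
open import Data.Sum using (_⊎_)
open import Relation.Binary.PropositionalEquality using (_≡_; _≢_)

-- A string x₁x₂⋯xₙ over [n]; symbol s ∈ [n] is encoded as (s-1) : Fin n,
-- position p ∈ [n] is encoded as index (p-1) : Fin n.
Word : ℕ → Set
Word n = Vec (Fin n) n

IsVertex : ∀ {n} → Word n → Set
IsVertex u = Unique u

swap12 : ∀ {n} → Word n → Word n
swap12 {suc (suc m)} u = (u [ zero ]≔ lookup u (suc zero)) [ suc zero ]≔ lookup u zero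
swap12 {zero} u = u
swap12 {suc zero} u = u

-- u s_k^- : y₁ = x₂, y₂ = x_k, y_k = x₁   (k given as 0-based position index)
sMinus : ∀ {n} → Fin n → Word n → Word n
sMinus {suc (suc m)} k u =
  ((u [ zero ]≔ lookup u (suc zero)) [ suc zero ]≔ lookup u k) [ k ]≔ lookup u zero
sMinus {zero} k u = u
sMinus {suc zero} k u = u

sPlus : ∀ {n} → Fin n → Word n → Word n
sPlus {suc (suc m)} k u =
  ((u [ zero ]≔ lookup u k) [ suc zero ]≔ lookup u zero) [ k ]≔ lookup u (suc zero)
sPlus {zero} k u = u
sPlus {suc zero} k u = u

sPlusLast : ∀ {n} → Word n → Word n
sPlusLast {suc m} u = sPlus (fromℕ m) u
sPlusLast {zero} u = u

sMinusLast : ∀ {n} → Word n → Word n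
sMinusLast {suc m} u = sMinus (fromℕ m) u
sMinusLast {zero} u = u

-- v is one of the generator-neighbours of u
-- (k ranges over positions [3,n], i.e. 0-based indices with 2 ≤ toℕ k)
Adj : ∀ {n} → Word n → Word n → Set
Adj {n} u v =
  v ≡ swap12 u ⊎
  Σ (Fin n) (λ k → 2 ≤ toℕ k × (v ≡ sMinus k u ⊎ v ≡ sPlus k u))

Edge : ∀ {n} → Word n → Word n → Set
Edge u v = IsVertex u × IsVertex v × Adj u v

LastIs : ∀ {n} → Fin n → Word n → Set
LastIs {suc m} i u = last u ≡ i
LastIs {zero} () u

-- {u,v} is an edge of S_n^{2:i} (induced subgraph on vertices with last symbol i)
EdgeIn : ∀ {n} → Fin n → Word n → Word n → Set
EdgeIn i u v = Edge u v × LastIs i u × LastIs i v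

Cycle4 : ∀ {n} → Word n → Word n → Word n → Word n → Set
Cycle4 a b c d =
  (Edge a b × Edge b c × Edge c d × Edge d a) ×
  (a ≢ b × a ≢ c × a ≢ d × b ≢ c × b ≢ d × c ≢ d)

{-# OPTIONS --safe #-}
module Submission where

-- Write u = x₁x₂⋯xₙ. The generators s_n^± move x₁ or x₂ to the last position, so u s_n^±
-- lies in a block S_n^{2:j} with j ≠ i. Away from position n they commute with the generator
-- of the edge uv up to flipping signs: u s_k^- s_n^- = u s_n^+ s_k^+ for k ≠ n, and
-- u (1,2) s_n^+ = u s_n^- (1,2). Choosing the signs of u′ and v′ accordingly makes u′v′ an edge
-- of S_n^{2:j}; the four vertices are distinct since no edge is a loop and u, v and u′, v′ lie
-- in different blocks.

open import Defs
open import Data.Nat using (ℕ; suc; zero; _≤_; z≤n; s≤s)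
open import Data.Fin using (Fin; zero; suc; fromℕ)
open import Data.Vec using (Vec; _∷_; []; head; lookup; _[_]≔_; last; map; allFin)
open import Data.Vec.Properties
  using (lookup-map; map-[]≔; map-lookup-allFin; lookup-allFin; tabulate∘lookup;
         lookup∘update; lookup∘update′; []≔-idempotent; []≔-commutes; []≔-lookup)
open import Data.Vec.Relation.Unary.Unique.Propositional using (Unique)
open import Data.Vec.Relation.Unary.Unique.Propositional.Properties using (lookup-injective; tabulate⁺)
open import Data.Product using (Σ; _×_; _,_; proj₁; proj₂)
open import Data.Sum using (_⊎_; inj₁; inj₂)
open import Function using (_∘_)
open import Relation.Nullary using (¬_)
open import Relation.Binary.PropositionalEquality
  using (_≡_; _≢_; ≢-sym; refl; sym; trans; cong; cong₂; subst; module ≡-Reasoning)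
open ≡-Reasoning

lookup-injective⇒Unique : ∀ {a} {A : Set a} {n} (xs : Vec A n) →
  (∀ {p q} → lookup xs p ≡ lookup xs q → p ≡ q) → Unique xs
lookup-injective⇒Unique xs injective = subst Unique (tabulate∘lookup xs) (tabulate⁺ injective)

lookup-≢ : ∀ {a} {A : Set a} {n} {xs : Vec A n} → Unique xs →
  ∀ {p q} → p ≢ q → lookup xs p ≢ lookup xs q
lookup-≢ U p≢q = p≢q ∘ lookup-injective U _ _

last≡lookup-fromℕ : ∀ {a} {A : Set a} {n} (xs : Vec A (suc n)) → last xs ≡ lookup xs (fromℕ n)
last≡lookup-fromℕ {n = zero} (x ∷ []) = refl
last≡lookup-fromℕ {n = suc n} (x ∷ xs) = last≡lookup-fromℕ xs

last-[fromℕ]≔ : ∀ {a} {A : Set a} {n} (xs : Vec A (suc n)) x → last (xs [ fromℕ n ]≔ x) ≡ x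
last-[fromℕ]≔ {n = n} xs x = trans (last≡lookup-fromℕ (xs [ fromℕ n ]≔ x)) (lookup∘update (fromℕ n) xs x)

-- A natural operator only rearranges positions; O (allFin n) records where each entry comes from.
Natural : ∀ {n} → (Word n → Word n) → Set
Natural {n} O = ∀ (f : Fin n → Fin n) w → O (map f w) ≡ map f (O w)

lookup-natural : ∀ {n} {O : Word n → Word n} → Natural O →
  ∀ u p → lookup (O u) p ≡ lookup u (lookup (O (allFin n)) p)
lookup-natural {n} {O} nat u p = begin
  lookup (O u) p                           ≡⟨ cong (λ w → lookup (O w) p) (map-lookup-allFin u) ⟨
  lookup (O (map (lookup u) (allFin n))) p ≡⟨ cong (λ w → lookup w p) (nat (lookup u) (allFin n)) ⟩
  lookup (map (lookup u) (O (allFin n))) p ≡⟨ lookup-map p (lookup u) (O (allFin n)) ⟩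
  lookup u (lookup (O (allFin n)) p)       ∎

natural-split-epi⇒Unique : ∀ {n} {O O′ : Word n → Word n} → Natural O → (∀ w → O (O′ w) ≡ w) →
  ∀ {u} → Unique u → Unique (O u)
natural-split-epi⇒Unique {n} {O} {O′} nat O∘O′≗id {u} U = lookup-injective⇒Unique (O u) injective
  where
  π ρ : Fin n → Fin n
  π = lookup (O (allFin n))
  ρ = lookup (O′ (allFin n))

  ρ∘π≗id : ∀ p → ρ (π p) ≡ p
  ρ∘π≗id p = begin
    ρ (π p)                      ≡⟨ lookup-natural nat (O′ (allFin n)) p ⟨
    lookup (O (O′ (allFin n))) p ≡⟨ cong (λ w → lookup w p) (O∘O′≗id (allFin n)) ⟩
    lookup (allFin n) p          ≡⟨ lookup-allFin p ⟩
    p                            ∎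

  injective : ∀ {p q} → lookup (O u) p ≡ lookup (O u) q → p ≡ q
  injective {p} {q} eq = begin
    p       ≡⟨ ρ∘π≗id p ⟨
    ρ (π p) ≡⟨ cong ρ (lookup-injective U (π p) (π q) π-eq) ⟩
    ρ (π q) ≡⟨ ρ∘π≗id q ⟩
    q       ∎
    where
    π-eq : lookup u (π p) ≡ lookup u (π q)
    π-eq = trans (sym (lookup-natural nat u p)) (trans eq (lookup-natural nat u q))

swap12-involutive : ∀ {n} (u : Word n) → swap12 (swap12 u) ≡ u
swap12-involutive {zero} u = refl
swap12-involutive {suc zero} u = refl
swap12-involutive {suc (suc n)} (a ∷ b ∷ r) = refl

sMinus∘sPlus : ∀ {m} (k : Fin m) (u : Word (suc (suc m))) →
  sMinus (suc (suc k)) (sPlus (suc (suc k)) u) ≡ u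
sMinus∘sPlus k (a ∷ b ∷ r) =
  cong (a ∷_) (cong₂ _∷_ (lookup∘update k r b) (trans ([]≔-idempotent r k) ([]≔-lookup r k)))

sPlus∘sMinus : ∀ {m} (k : Fin m) (u : Word (suc (suc m))) →
  sPlus (suc (suc k)) (sMinus (suc (suc k)) u) ≡ u
sPlus∘sMinus k (a ∷ b ∷ r) =
  cong₂ _∷_ (lookup∘update k r a) (cong (b ∷_) (trans ([]≔-idempotent r k) ([]≔-lookup r k)))

sMinus-natural : ∀ {m} (k : Fin m) → Natural (sMinus {suc (suc m)} (suc (suc k)))
sMinus-natural k f (a ∷ b ∷ r) =
  cong (f b ∷_) (cong₂ _∷_ (lookup-map k f r) (sym (map-[]≔ f r k)))

sPlus-natural : ∀ {m} (k : Fin m) → Natural (sPlus {suc (suc m)} (suc (suc k)))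
sPlus-natural k f (a ∷ b ∷ r) =
  cong₂ _∷_ (lookup-map k f r) (cong (f a ∷_) (sym (map-[]≔ f r k)))

sMinus-Unique : ∀ {m} (k : Fin m) {u : Word (suc (suc m))} → Unique u → Unique (sMinus (suc (suc k)) u)
sMinus-Unique k = natural-split-epi⇒Unique (sMinus-natural k) (sMinus∘sPlus k)

sPlus-Unique : ∀ {m} (k : Fin m) {u : Word (suc (suc m))} → Unique u → Unique (sPlus (suc (suc k)) u)
sPlus-Unique k = natural-split-epi⇒Unique (sPlus-natural k) (sPlus∘sMinus k)

sMinus∘sMinus≡sPlus∘sPlus : ∀ {m} {k l : Fin m} → k ≢ l → (u : Word (suc (suc m))) →
  sMinus (suc (suc l)) (sMinus (suc (suc k)) u) ≡ sPlus (suc (suc k)) (sPlus (suc (suc l)) u)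
sMinus∘sMinus≡sPlus∘sPlus {k = k} {l} k≢l (a ∷ b ∷ r) =
  cong₂ _∷_ (sym (lookup∘update′ k≢l r b))
    (cong₂ _∷_ (lookup∘update′ (≢-sym k≢l) r a) ([]≔-commutes r k l k≢l))

sPlus∘swap12≡swap12∘sMinus : ∀ {m} (l : Fin m) (u : Word (suc (suc m))) →
  sPlus (suc (suc l)) (swap12 u) ≡ swap12 (sMinus (suc (suc l)) u)
sPlus∘swap12≡swap12∘sMinus l (a ∷ b ∷ r) = refl

Adj-sym : ∀ {n} {u v : Word n} → Adj u v → Adj v u
Adj-sym {u = u} (inj₁ refl) = inj₁ (sym (swap12-involutive u))
Adj-sym (inj₂ (zero , () , _))
Adj-sym (inj₂ (suc zero , s≤s () , _))
Adj-sym {u = u} (inj₂ (suc (suc k) , 2≤k , inj₁ refl)) = inj₂ (suc (suc k) , 2≤k , inj₂ (sym (sPlus∘sMinus k u)))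
Adj-sym {u = u} (inj₂ (suc (suc k) , 2≤k , inj₂ refl)) = inj₂ (suc (suc k) , 2≤k , inj₁ (sym (sMinus∘sPlus k u)))

Edge-sym : ∀ {n} {u v : Word n} → Edge u v → Edge v u
Edge-sym (U , V , adj) = V , U , Adj-sym adj

-- Every generator moves x₁ onto position 2 or x₂ onto position 1.
Edge⇒≢ : ∀ {m} {u v : Word (suc (suc m))} → Edge u v → u ≢ v
Edge⇒≢ {u = a ∷ b ∷ r} {v} (U , _ , adj) u≡v = lookup-≢ U {zero} {suc zero} (λ ()) (a≡b adj)
  where
  a≡b : Adj (a ∷ b ∷ r) v → a ≡ b
  a≡b (inj₁ v≡) = cong head (trans u≡v v≡)
  a≡b (inj₂ (zero , () , _))
  a≡b (inj₂ (suc zero , s≤s () , _))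
  a≡b (inj₂ (suc (suc k) , _ , inj₁ v≡)) = cong head (trans u≡v v≡)
  a≡b (inj₂ (suc (suc k) , _ , inj₂ v≡)) = sym (cong (λ w → lookup w (suc zero)) (trans u≡v v≡))

LastIs⇒≢ : ∀ {n} {i j : Fin n} {w w′ : Word n} → i ≢ j → LastIs i w → LastIs j w′ → w ≢ w′
LastIs⇒≢ {suc n} i≢j refl refl refl = i≢j refl

LastNeighbour : ∀ {n} → Word n → Word n → Set
LastNeighbour u u′ = u′ ≡ sPlusLast u ⊎ u′ ≡ sMinusLast u

last-sPlusLast : ∀ {m} (u : Word (suc (suc (suc m)))) → last (sPlusLast u) ≡ lookup u (suc zero)
last-sPlusLast (a ∷ b ∷ r) = last-[fromℕ]≔ r b

last-sMinusLast : ∀ {m} (u : Word (suc (suc (suc m)))) → last (sMinusLast u) ≡ lookup u zero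
last-sMinusLast (a ∷ b ∷ r) = last-[fromℕ]≔ r a

LastNeighbour⇒Edge : ∀ {m} {u u′ : Word (suc (suc (suc m)))} → Unique u → LastNeighbour u u′ → Edge u u′
LastNeighbour⇒Edge {m} U (inj₁ refl) = U , sPlus-Unique (fromℕ m) U , inj₂ (_ , s≤s (s≤s z≤n) , inj₂ refl)
LastNeighbour⇒Edge {m} U (inj₂ refl) = U , sMinus-Unique (fromℕ m) U , inj₂ (_ , s≤s (s≤s z≤n) , inj₁ refl)

LastNeighbour⇒¬LastIs : ∀ {m} {i} {u u′ : Word (suc (suc (suc m)))} →
  Unique u → LastIs i u → LastNeighbour u u′ → ¬ LastIs i u′
LastNeighbour⇒¬LastIs {u = u} U refl (inj₁ refl) u′∈i =
  lookup-≢ U (λ ()) (trans (sym (last-sPlusLast u)) (trans u′∈i (last≡lookup-fromℕ u)))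
LastNeighbour⇒¬LastIs {u = u} U refl (inj₂ refl) u′∈i =
  lookup-≢ U (λ ()) (trans (sym (last-sMinusLast u)) (trans u′∈i (last≡lookup-fromℕ u)))

Cycle4-across-blocks : ∀ {m} {i j : Fin (suc (suc m))} {u v u′ v′ : Word (suc (suc m))} →
  j ≢ i → EdgeIn i u v → EdgeIn j u′ v′ → Edge u u′ → Edge v v′ → Cycle4 u u′ v′ v
Cycle4-across-blocks j≢i (uv , u∈i , v∈i) (u′v′ , u′∈j , v′∈j) uu′ vv′ =
  (uu′ , u′v′ , Edge-sym vv′ , Edge-sym uv) ,
  LastIs⇒≢ i≢j u∈i u′∈j , LastIs⇒≢ i≢j u∈i v′∈j , Edge⇒≢ uv ,
  Edge⇒≢ u′v′ , LastIs⇒≢ j≢i u′∈j v∈i , LastIs⇒≢ j≢i v′∈j v∈i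
  where
  i≢j = ≢-sym j≢i

CoupledPairEdge : ∀ {n} → Fin n → Word n → Word n → Set
CoupledPairEdge {n} i u v =
  Σ (Word n) λ u′ → LastNeighbour u u′ ×
  Σ (Word n) λ v′ → LastNeighbour v v′ ×
  Σ (Fin n) (λ j → j ≢ i × EdgeIn j u′ v′) ×
  Cycle4 u u′ v′ v

coupledPairEdge : ∀ {m} {i j : Fin (suc (suc (suc m)))} {u v u′ v′ : Word (suc (suc (suc m)))} →
  EdgeIn i u v → LastNeighbour u u′ → LastNeighbour v v′ → Adj u′ v′ → LastIs j u′ → LastIs j v′ →
  CoupledPairEdge i u v
coupledPairEdge {i = i} {j} {u} {v} {u′} {v′} e@((U , V , _) , u∈i , _) uu′ vv′ adj u′∈j v′∈j =
  u′ , uu′ , v′ , vv′ , (j , j≢i , e′) , Cycle4-across-blocks j≢i e e′ Euu′ Evv′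
  where
  Euu′ : Edge u u′
  Euu′ = LastNeighbour⇒Edge U uu′

  Evv′ : Edge v v′
  Evv′ = LastNeighbour⇒Edge V vv′

  e′ : EdgeIn j u′ v′
  e′ = (proj₁ (proj₂ Euu′) , proj₁ (proj₂ Evv′) , adj) , u′∈j , v′∈j

  j≢i : j ≢ i
  j≢i j≡i = LastNeighbour⇒¬LastIs U u∈i uu′ (subst (λ j → LastIs j u′) j≡i u′∈j)

coupled-swap12 : ∀ {m} {i} (u : Word (suc (suc (suc m)))) →
  EdgeIn i u (swap12 u) → CoupledPairEdge i u (swap12 u)
coupled-swap12 {m} u@(_ ∷ _ ∷ _) e =
  coupledPairEdge e (inj₂ refl) (inj₁ refl) (inj₁ (sPlus∘swap12≡swap12∘sMinus (fromℕ m) u))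
    (last-sMinusLast u) (last-sPlusLast (swap12 u))

coupled-sMinus : ∀ {m} {i} (k : Fin (suc m)) (u : Word (suc (suc (suc m)))) →
  EdgeIn i u (sMinus (suc (suc k)) u) → CoupledPairEdge i u (sMinus (suc (suc k)) u)
coupled-sMinus {m} k u@(_ ∷ _ ∷ _) e@((U , _) , u∈i , v∈i) =
  coupledPairEdge e (inj₁ refl) (inj₂ refl)
    (inj₂ (suc (suc k) , s≤s (s≤s z≤n) , inj₂ (sMinus∘sMinus≡sPlus∘sPlus k≢n u)))
    (last-sPlusLast u) (last-sMinusLast (sMinus (suc (suc k)) u))
  where
  k≢n : k ≢ fromℕ m
  k≢n k≡n = LastNeighbour⇒¬LastIs U u∈i (inj₂ refl)
    (subst (λ k → LastIs _ (sMinus (suc (suc k)) u)) k≡n v∈i)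

coupled-sPlus : ∀ {m} {i} (k : Fin (suc m)) (u : Word (suc (suc (suc m)))) →
  EdgeIn i u (sPlus (suc (suc k)) u) → CoupledPairEdge i u (sPlus (suc (suc k)) u)
coupled-sPlus {m} k u@(_ ∷ _ ∷ _) e@((U , _) , u∈i , v∈i) =
  coupledPairEdge e (inj₂ refl) (inj₁ refl)
    (inj₂ (suc (suc k) , s≤s (s≤s z≤n) , inj₁ (sym (sMinus∘sMinus≡sPlus∘sPlus (≢-sym k≢n) u))))
    (last-sMinusLast u) (last-sPlusLast (sPlus (suc (suc k)) u))
  where
  k≢n : k ≢ fromℕ m
  k≢n k≡n = LastNeighbour⇒¬LastIs U u∈i (inj₁ refl)
    (subst (λ k → LastIs _ (sPlus (suc (suc k)) u)) k≡n v∈i)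

lemma2p8 : (n : ℕ) → 3 ≤ n → (i : Fin n) → (u v : Word n) → EdgeIn i u v →
    Σ (Word n) (λ u′ → (u′ ≡ sPlusLast u ⊎ u′ ≡ sMinusLast u) ×
    Σ (Word n) (λ v′ → (v′ ≡ sPlusLast v ⊎ v′ ≡ sMinusLast v) ×
    Σ (Fin n) (λ j → j ≢ i × EdgeIn j u′ v′) ×
    Cycle4 u u′ v′ v))
lemma2p8 (suc (suc (suc m))) (s≤s (s≤s (s≤s z≤n))) i u v e@((_ , _ , adj) , _) with adj
... | inj₁ refl = coupled-swap12 u e
... | inj₂ (zero , () , _)
... | inj₂ (suc zero , s≤s () , _)
... | inj₂ (suc (suc k) , _ , inj₁ refl) = coupled-sMinus k u e
... | inj₂ (suc (suc k) , _ , inj₂ refl) = coupled-sPlus k u e
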